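{- Let $\langle\Gamma,F,\vec{f}\rangle\in W^c$, let $a$ be an agent and $\phi_1,\phi_2\in\mathcal{L}_{ELKy^r}$ with $Ky_a^r(\phi_1,\phi_2)\notin\Gamma$. Then for every $s_{\phi_3}\in E^c$ there exists $\langle\Delta,G,\vec{g}\rangle\in W^c$ such that $(\langle\Gamma,F,\vec{f}\rangle,\langle\Delta,G,\vec{g}\rangle)\in R^c_a$, $\phi_1\in\Delta$ and $(s_{\phi_3},\phi_2)\notin G$.
   Context: $\mathcal{L}_{ELKy^r}$: $\phi ::= p\mid\neg\phi\mid(\phi\land\phi)\mid K_a\phi\mid Ky_a^r(\phi,\phi)$ over a countably infinite set of atoms $\mathcal{P}$ and countable set of agents $\mathcal{A}$. $\Lambda\subseteq\mathcal{L}_{ELKy^r}$ is a fixed set (tautology ground). $\mathbb{SKYR}$ is the Hilbert system with axioms (PT) propositional tautologies; (K) $K_a(\phi\to\psi)\to(K_a\phi\to K_a\psi)$; (T) $K_a\phi\to\phi$; (4) $K_a\phi\to K_aK_a\phi$; (5) $\neg K_a\phi\to K_a\neg K_a\phi$; (EKyR) $Ky_a^r(\chi,\phi\to\psi)\to(Ky_a^r(\theta,\phi)\to Ky_a^r(\chi\land\theta,\psi))$; (4YKR) $Ky_a^r(\phi,\psi)\to K_aKy_a^r(\phi,\psi)$; (DKyR) $Ky_a^r(\phi,\psi)\to K_a(\phi\to\psi)$; (IKyR) $Ky_a^r(\psi,\chi)\to(K_a(\phi\to\psi)\to Ky_a^r(\phi,\chi))$; (UKyR) $K_a\neg\phi\to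 Ky_a^r(\phi,\psi)$; rules (MP), (NK), (NKyR) from $\phi\in\Lambda$ infer $\vdash Ky_a^r(\top,\phi)$; maximal consistent sets as usual. $\hat{E}^c$ is the set of terms $t::=e\mid\phi\mid(t\cdot t)$ with $\phi\in\mathcal{L}_{ELKy^r}$. $E^c=\{e_\top\}\cup\{t_\phi\mid t\in\hat{E}^c\setminus\{e\},\phi\in\mathcal{L}_{ELKy^r}\}$, with $t_\phi\cdot s_\psi:=(t\cdot s)_{\phi\land\psi}$ ($e_\top$ read as $t=e,\phi=\top$); every element of $E^c$ is written $s_\phi$. $W^c$ is the set of triples $\langle\Gamma,F,\vec{f}\rangle$ with $\Gamma$ maximal consistent, $F\subseteq E^c\times\mathcal{L}_{ELKy^r}$, $\vec{f}=(f^\phi_a)_{a,\phi}$ with $f^\phi_a:\{\psi\mid Ky_a^r(\phi,\psi)\in\Gamma\}\to E^c$, such that: (1) $(s_\alpha,\phi\to\psi),(r_\beta,\phi)\in F$ implies $((s\cdot r)_{\alpha\land\beta},\psi)\in F$; (2) $\phi\in\Lambda$ implies $(e_\top,\phi)\in F$; (3) if $Ky_a^r(\phi,\psi)\land\phi\in\Gamma$ then $(f_a^\phi(\psi),\psi)\in F$; (4) each $f_a^\phi(\psi)$ is of the form $t_\phi$ with $t\in\hat{E}^c$. $R^c_a$ relates $\langle\Gamma,F,\vec f\rangle$ to $\langle\Delta,G,\vec g\rangle$ iff $\{\phi\mid K_a\phi\in\Gamma\}\subseteq\Delta$ and $f^\phi_a=g^\phi_a$ for all $\phi$. -}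

module Defs where

open import Data.Nat using (ℕ)
open import Data.Bool using (Bool; true; false; not; _∧_)
open import Data.List using (List; []; _∷_)
open import Data.List.Relation.Unary.All using (All)
open import Data.Product using (Σ; _×_; _,_)
open import Data.Sum using (_⊎_)
open import Relation.Nullary using (¬_)
open import Relation.Binary.PropositionalEquality using (_≡_; _≢_)

infixr 6 _&_
infixr 5 _⇒_
infix 7 ~_

data Fm (Ag : Set) : Set where
  atom : ℕ → Fm Ag
  ~_   : Fm Ag → Fm Ag
  _&_  : Fm Ag → Fm Ag → Fm Ag
  K    : Ag → Fm Ag → Fm Ag
  Ky   : Ag → Fm Ag → Fm Ag → Fm Ag

_⇒_ : {Ag : Set} → Fm Ag → Fm Ag → Fm Ag
φ ⇒ ψ = ~ (φ & ~ ψ)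

⊤f : {Ag : Set} → Fm Ag
⊤f = ~ (atom 0 & ~ atom 0)

-- Propositional tautologies: true under every Boolean valuation that
-- treats atoms and modal formulas (K_a φ, Ky_a^r(φ,ψ)) as propositional
-- letters, i.e. substitution instances of classical tautologies.
eval : {Ag : Set} → (Fm Ag → Bool) → Fm Ag → Bool
eval v (atom p)   = v (atom p)
eval v (~ φ)      = not (eval v φ)
eval v (φ & ψ)    = eval v φ ∧ eval v ψ
eval v (K a φ)    = v (K a φ)
eval v (Ky a φ ψ) = v (Ky a φ ψ)

Taut : {Ag : Set} → Fm Ag → Set
Taut {Ag} φ = (v : Fm Ag → Bool) → eval v φ ≡ true

conj : {Ag : Set} → List (Fm Ag) → Fm Ag
conj []       = ⊤f
conj (φ ∷ L)  = φ & conj L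

-- Terms Ê^c and the raw carrier of E^c (pairs t_φ = (t , φ))

data Term (Ag : Set) : Set where
  e    : Term Ag
  fm   : Fm Ag → Term Ag
  _·_  : Term Ag → Term Ag → Term Ag

Ec : Set → Set
Ec Ag = Term Ag × Fm Ag

InEc : {Ag : Set} → Ec Ag → Set
InEc (t , φ) = (t ≢ e) ⊎ ((t ≡ e) × (φ ≡ ⊤f))

eTop : {Ag : Set} → Ec Ag
eTop = e , ⊤f

_⊙_ : {Ag : Set} → Ec Ag → Ec Ag → Ec Ag
(t , φ) ⊙ (s , ψ) = (t · s) , (φ & ψ)

-- The Hilbert system SKYR, parameterised by the tautology ground Λ

module Logic (Ag : Set) (Λ : Fm Ag → Set) where

  infix 2 ⊢_
  data ⊢_ : Fm Ag → Set where
    PT   : ∀ {φ} → Taut φ → ⊢ φ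
    AxK  : ∀ a φ ψ → ⊢ (K a (φ ⇒ ψ) ⇒ (K a φ ⇒ K a ψ))
    AxT  : ∀ a φ → ⊢ (K a φ ⇒ φ)
    Ax4  : ∀ a φ → ⊢ (K a φ ⇒ K a (K a φ))
    Ax5  : ∀ a φ → ⊢ (~ K a φ ⇒ K a (~ K a φ))
    EKyR : ∀ a χ φ ψ θ → ⊢ (Ky a χ (φ ⇒ ψ) ⇒ (Ky a θ φ ⇒ Ky a (χ & θ) ψ))
    4YKR : ∀ a φ ψ → ⊢ (Ky a φ ψ ⇒ K a (Ky a φ ψ))
    DKyR : ∀ a φ ψ → ⊢ (Ky a φ ψ ⇒ K a (φ ⇒ ψ))
    IKyR : ∀ a φ ψ χ → ⊢ (Ky a ψ χ ⇒ (K a (φ ⇒ ψ) ⇒ Ky a φ χ))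
    UKyR : ∀ a φ ψ → ⊢ (K a (~ φ) ⇒ Ky a φ ψ)
    MP   : ∀ {φ ψ} → ⊢ (φ ⇒ ψ) → ⊢ φ → ⊢ ψ
    NK   : ∀ {φ} a → ⊢ φ → ⊢ K a φ
    NKyR : ∀ {φ} a → Λ φ → ⊢ Ky a ⊤f φ

  FSet : Set₁
  FSet = Fm Ag → Set

  _⊆_ : FSet → FSet → Set
  Γ ⊆ Δ = ∀ φ → Γ φ → Δ φ

  Consistent : FSet → Set
  Consistent Γ = ¬ (Σ (List (Fm Ag)) λ L → All Γ L × (⊢ ~ conj L))

  MaxCons : FSet → Set₁
  MaxCons Γ = Consistent Γ × ((Δ : FSet) → Γ ⊆ Δ → Consistent Δ → Δ ⊆ Γ)

  -- The canonical worlds W^c.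
  -- f a φ is total on formulas; only its values on the domain
  -- {ψ | Ky_a^r(φ,ψ) ∈ Γ} are constrained / compared.

  record World : Set₁ where
    field
      Γ    : FSet
      mcs  : MaxCons Γ
      F    : Ec Ag → Fm Ag → Set
      F⊆   : ∀ s χ → F s χ → InEc s
      f    : Ag → Fm Ag → Fm Ag → Ec Ag
      fEc  : ∀ a φ ψ → Γ (Ky a φ ψ) → InEc (f a φ ψ)
      c1   : ∀ s r φ ψ → F s (φ ⇒ ψ) → F r φ → F (s ⊙ r) ψ
      c2   : ∀ φ → Λ φ → F eTop φ
      c3   : ∀ a φ ψ → Γ (Ky a φ ψ & φ) → F (f a φ ψ) ψ
      c4   : ∀ a φ ψ → Γ (Ky a φ ψ) → Σ (Term Ag) λ t → f a φ ψ ≡ (t , φ)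

  open World public

  -- R^c_a : {φ | K_a φ ∈ Γ} ⊆ Δ and f^φ_a = g^φ_a (as partial functions:
  -- same domain and same values on it)
  Rc : Ag → World → World → Set
  Rc a w v =
    (∀ φ → Γ w (K a φ) → Γ v φ) ×
    (∀ φ → ((∀ ψ → Γ w (Ky a φ ψ) → Γ v (Ky a φ ψ)) ×
            (∀ ψ → Γ v (Ky a φ ψ) → Γ w (Ky a φ ψ))) ×
           (∀ ψ → Γ w (Ky a φ ψ) → f w a φ ψ ≡ f v a φ ψ))

module Submission where

-- Let w = ⟨Γ,F,f⟩ with Ky_a(φ₁,φ₂) ∉ Γ and let s = t₃_{φ₃}.  The successor is built
-- from one general construction (`successor`): whenever K_a ¬θ ∉ Γ, the set
-- {ψ | K_a ψ ∈ Γ} ∪ {θ} is consistent, so it extends (Lindenbaum) to a maximal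
-- consistent Δ; on Δ we put an evidence relation no larger than the witnessing
-- functions of w require, namely  (t_α , ψ) ∈ G  iff  α ∈ Δ and either
-- Ky_a(α,ψ) ∈ Δ (equivalently ∈ Γ, by 4YKR and 5) or t is bigger than t₃.
-- The theorem then splits on Ky_a(φ₃,φ₂) ∈ Γ:
--   * if it holds, take θ = φ₁ ∧ ¬φ₃ (K_a ¬θ ∉ Γ by IKyR); (s,φ₂) ∈ G would force φ₃ ∈ Δ;
--   * otherwise take θ = φ₁ (K_a ¬θ ∉ Γ by UKyR); (s,φ₂) ∈ G would force
--     Ky_a(φ₃,φ₂) ∈ Γ or t₃ bigger than itself.

open import Defs
open import Level using (0ℓ)
open import Axiom.ExcludedMiddle using (ExcludedMiddle)
open import Data.Nat using (ℕ; zero; suc; _+_; _≟_; _<_; _≤_; _⊔_; _≤′_; ≤′-refl; ≤′-step)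
open import Data.Nat.Properties using (≤-trans; m≤m+n; m≤n+m; n≤1+n; ≤⇒≤′; m≤m⊔n; m≤n⊔m; <-irrefl; n<1+n)
open import Data.Nat.Binary using (ℕᵇ; zero; 2[1+_]; 1+[2_]; toℕ)
open import Data.Nat.Binary.Properties using (toℕ-injective)
open import Data.Bool using (Bool; true; false; not; T)
open import Data.Bool.Properties using (T-∧; T-≡)
open import Data.Unit using (tt)
open import Data.List using (List; []; _∷_; _++_)
open import Data.List.Relation.Unary.All using (All; []; _∷_)
import Data.List.Relation.Unary.All as All
open import Data.List.Relation.Unary.All.Properties using (++⁺; ++⁻)
open import Data.Product using (Σ; _×_; _,_; proj₁; proj₂)
open import Data.Sum using (_⊎_; inj₁; inj₂)
open import Data.Empty using (⊥; ⊥-elim)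
open import Function using (_∘_)
open import Function.Bundles using (Equivalence)
open import Function.Definitions using (Injective)
open import Relation.Nullary using (¬_; Dec; yes; no)
open import Relation.Nullary.Decidable using (map′; T?)
open import Relation.Binary.PropositionalEquality using (_≡_; refl; sym; trans; cong)

-- A binary numeral is read as a bit string (least significant bit first):
-- 1+[2 r] is "0 then r" and 2[1+ r] is "1 then r".  Formulas get a prefix-free
-- code, so concatenated codes can be split uniquely.

module Coding {Ag : Set} (enc : Ag → ℕ) (enc-injective : Injective _≡_ _≡_ enc) where

  O I : ℕᵇ → ℕᵇ
  O = 1+[2_]
  I = 2[1+_]

  drop : ℕ → ℕᵇ → ℕᵇ
  drop zero    r        = r
  drop (suc n) zero     = zero
  drop (suc n) 2[1+ r ] = drop n r
  drop (suc n) 1+[2 r ] = drop n r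

  unary : ℕ → ℕᵇ → ℕᵇ
  unary zero    r = O r
  unary (suc n) r = I (unary n r)

  -- Tags 00 atom, 01 ¬, 100 ∧, 101 K, 11 Ky, followed by the codes of the parts, then r.
  bits : Fm Ag → ℕᵇ → ℕᵇ
  bits (atom p)   r = O (O (unary p r))
  bits (~ φ)      r = O (I (bits φ r))
  bits (φ & ψ)    r = I (O (O (bits φ (bits ψ r))))
  bits (K b φ)    r = I (O (I (unary (enc b) (bits φ r))))
  bits (Ky b φ ψ) r = I (I (unary (enc b) (bits φ (bits ψ r))))

  unary-injective : ∀ m n {r s} → unary m r ≡ unary n s → m ≡ n × r ≡ s
  unary-injective zero    zero    eq = refl , cong (drop 1) eq
  unary-injective (suc m) (suc n) eq with unary-injective m n (cong (drop 1) eq)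
  ... | refl , r≡s = refl , r≡s

  bits-injective : ∀ φ ψ {r s} → bits φ r ≡ bits ψ s → φ ≡ ψ × r ≡ s
  bits-injective (atom p) (atom q) eq with unary-injective p q (cong (drop 2) eq)
  ... | refl , r≡s = refl , r≡s
  bits-injective (~ φ) (~ ψ) eq with bits-injective φ ψ (cong (drop 2) eq)
  ... | refl , r≡s = refl , r≡s
  bits-injective (φ & φ′) (ψ & ψ′) eq with bits-injective φ ψ (cong (drop 3) eq)
  ... | refl , eq′ with bits-injective φ′ ψ′ eq′
  ...   | refl , r≡s = refl , r≡s
  bits-injective (K b φ) (K c ψ) eq with unary-injective (enc b) (enc c) (cong (drop 3) eq)
  ... | eb , eq′ with enc-injective eb | bits-injective φ ψ eq′
  ...   | refl | refl , r≡s = refl , r≡s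
  bits-injective (Ky b φ φ′) (Ky c ψ ψ′) eq with unary-injective (enc b) (enc c) (cong (drop 2) eq)
  ... | eb , eq′ with enc-injective eb | bits-injective φ ψ eq′
  ...   | refl | refl , eq″ with bits-injective φ′ ψ′ eq″
  ...     | refl , r≡s = refl , r≡s
  bits-injective (atom _) (~ _) ()
  bits-injective (atom _) (_ & _) ()
  bits-injective (atom _) (K _ _) ()
  bits-injective (atom _) (Ky _ _ _) ()
  bits-injective (~ _) (atom _) ()
  bits-injective (~ _) (_ & _) ()
  bits-injective (~ _) (K _ _) ()
  bits-injective (~ _) (Ky _ _ _) ()
  bits-injective (_ & _) (atom _) ()
  bits-injective (_ & _) (~ _) ()
  bits-injective (_ & _) (K _ _) ()
  bits-injective (_ & _) (Ky _ _ _) ()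
  bits-injective (K _ _) (atom _) ()
  bits-injective (K _ _) (~ _) ()
  bits-injective (K _ _) (_ & _) ()
  bits-injective (K _ _) (Ky _ _ _) ()
  bits-injective (Ky _ _ _) (atom _) ()
  bits-injective (Ky _ _ _) (~ _) ()
  bits-injective (Ky _ _ _) (_ & _) ()
  bits-injective (Ky _ _ _) (K _ _) ()

  code : Fm Ag → ℕ
  code φ = toℕ (bits φ zero)

  code-injective : ∀ {φ ψ} → code φ ≡ code ψ → φ ≡ ψ
  code-injective {φ} {ψ} eq = proj₁ (bits-injective φ ψ (toℕ-injective eq))

module Semantics {Ag : Set} where

  -- A record, so that v and φ can be inferred from Holds v φ.
  record Holds (v : Fm Ag → Bool) (φ : Fm Ag) : Set where
    constructor holds
    field truth : T (eval v φ)
  open Holds public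

  T-not-intro : ∀ {x} → ¬ T x → T (not x)
  T-not-intro {true}  h = h tt
  T-not-intro {false} _ = tt

  T-not-elim : ∀ {x} → T (not x) → ¬ T x
  T-not-elim {true}  () _
  T-not-elim {false} _ ()

  module _ {v : Fm Ag → Bool} where

    holds? : ∀ φ → Dec (Holds v φ)
    holds? φ = map′ holds truth (T? (eval v φ))

    ~-intro : ∀ {φ} → ¬ Holds v φ → Holds v (~ φ)
    ~-intro h = holds (T-not-intro (h ∘ holds))

    ~-elim : ∀ {φ} → Holds v (~ φ) → ¬ Holds v φ
    ~-elim (holds nt) (holds t) = T-not-elim nt t

    &-intro : ∀ {φ ψ} → Holds v φ → Holds v ψ → Holds v (φ & ψ)
    &-intro (holds p) (holds q) = holds (Equivalence.from T-∧ (p , q))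

    &-elim : ∀ {φ ψ} → Holds v (φ & ψ) → Holds v φ × Holds v ψ
    &-elim (holds pq) = let (p , q) = Equivalence.to T-∧ pq in holds p , holds q

    ⇒-intro : ∀ {φ ψ} → (Holds v φ → Holds v ψ) → Holds v (φ ⇒ ψ)
    ⇒-intro h = ~-intro λ p&¬q → let (p , ¬q) = &-elim p&¬q in ~-elim ¬q (h p)

    ⇒-elim : ∀ {φ ψ} → Holds v (φ ⇒ ψ) → Holds v φ → Holds v ψ
    ⇒-elim {ψ = ψ} h p with holds? ψ
    ... | yes q = q
    ... | no ¬q = ⊥-elim (~-elim h (&-intro p (~-intro ¬q)))

    ⊤-holds : Holds v ⊤f
    ⊤-holds = ⇒-intro (λ p → p)

    conj-intro : ∀ L → All (Holds v) L → Holds v (conj L)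
    conj-intro []      []       = ⊤-holds
    conj-intro (_ ∷ L) (p ∷ ps) = &-intro p (conj-intro L ps)

    conj-elim : ∀ L → Holds v (conj L) → All (Holds v) L
    conj-elim []      _ = []
    conj-elim (_ ∷ L) h = let (p , ps) = &-elim h in p ∷ conj-elim L ps

  separate : (P : Fm Ag → Set) (x : Fm Ag) → ∀ {M} → All (λ y → P y ⊎ y ≡ x) M →
             Σ (List (Fm Ag)) λ M′ → All P M′ ×
               (∀ v → All (Holds v) M′ → Holds v x → All (Holds v) M)
  separate P x [] = [] , [] , (λ _ _ _ → [])
  separate P x (inj₁ p ∷ ps) with separate P x ps
  ... | M′ , all , ent = (_ ∷ M′) , (p ∷ all) , (λ { v (q ∷ qs) r → q ∷ ent v qs r })
  separate P x (inj₂ refl ∷ ps) with separate P x ps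
  ... | M′ , all , ent = M′ , all , (λ v qs r → r ∷ ent v qs r)

module Derivations (Ag : Set) (Λ : Fm Ag → Set) where
  open Logic Ag Λ
  open Semantics {Ag}

  valid : ∀ {φ} → (∀ v → Holds v φ) → ⊢ φ
  valid h = PT (λ v → Equivalence.to T-≡ (truth (h v)))

  tautology : ∀ {φ ψ} → (∀ v → Holds v φ → Holds v ψ) → ⊢ (φ ⇒ ψ)
  tautology h = valid (λ v → ⇒-intro (h v))

  consequence : ∀ {φ ψ} → ⊢ φ → (∀ v → Holds v φ → Holds v ψ) → ⊢ ψ
  consequence p h = MP (tautology h) p

  contrapositive : ∀ {φ ψ} → ⊢ (φ ⇒ ψ) → ⊢ (~ ψ ⇒ ~ φ)
  contrapositive h = consequence h (λ v φ⇒ψ → ⇒-intro λ ¬ψ → ~-intro λ φ → ~-elim ¬ψ (⇒-elim φ⇒ψ φ))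

  consistent-⊆ : ∀ {A B : FSet} → A ⊆ B → Consistent B → Consistent A
  consistent-⊆ A⊆B cB (L , inA , d) = cB (L , All.map (λ {y} → A⊆B y) inA , d)

  module MaxConsProps (LEM : ExcludedMiddle 0ℓ) (G : FSet) (m : MaxCons G) where

    private
      consistent = proj₁ m
      maximal    = proj₂ m

    closed : ∀ L {φ} → All G L → ⊢ (conj L ⇒ φ) → G φ
    closed L {φ} inL d = maximal (λ x → G x ⊎ x ≡ φ) (λ _ → inj₁) consistent-with-φ φ (inj₂ refl)
      where
      consistent-with-φ : Consistent (λ x → G x ⊎ x ≡ φ)
      consistent-with-φ (M , inM , ¬M) with separate G φ inM
      ... | M′ , inM′ , ent = consistent ((M′ ++ L) , ++⁺ inM′ inL ,
            consequence (MP (MP (tautology (λ v L⇒φ → ⇒-intro λ ¬M → ~-intro λ M′L →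
              let (M′s , Ls) = ++⁻ M′ (conj-elim (M′ ++ L) M′L)
              in ~-elim ¬M (conj-intro M (ent v M′s (⇒-elim L⇒φ (conj-intro L Ls)))))) d) ¬M)
              (λ v h → h))

    thm-in : ∀ {φ} → ⊢ φ → G φ
    thm-in p = closed [] [] (consequence p (λ v φ → ⇒-intro (λ _ → φ)))

    entails-in : ∀ {φ ψ} → (∀ v → Holds v φ → Holds v ψ) → G φ → G ψ
    entails-in h p = closed (_ ∷ []) (p ∷ []) (tautology (λ v φ∧⊤ → h v (proj₁ (&-elim φ∧⊤))))

    mp-in : ∀ {φ ψ} → G (φ ⇒ ψ) → G φ → G ψ
    mp-in p q = closed (_ ∷ _ ∷ []) (p ∷ q ∷ [])
      (tautology (λ v h → let (φ⇒ψ , rest) = &-elim h in ⇒-elim φ⇒ψ (proj₁ (&-elim rest))))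

    and-in : ∀ {φ ψ} → G φ → G ψ → G (φ & ψ)
    and-in p q = closed (_ ∷ _ ∷ []) (p ∷ q ∷ [])
      (tautology (λ v h → let (φ , rest) = &-elim h in &-intro φ (proj₁ (&-elim rest))))

    not-both : ∀ {φ} → G φ → G (~ φ) → ⊥
    not-both {φ} p q = consistent ((φ ∷ ~ φ ∷ []) , (p ∷ q ∷ []) ,
      valid (λ v → ~-intro λ h → let (φ , rest) = &-elim h in ~-elim (proj₁ (&-elim rest)) φ))

    neg-complete : ∀ φ → G φ ⊎ G (~ φ)
    neg-complete φ with LEM {G φ}
    ... | yes p = inj₁ p
    ... | no ¬p = inj₂ (maximal (λ x → G x ⊎ x ≡ ~ φ) (λ _ → inj₁) consistent-with-¬φ (~ φ) (inj₂ refl))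
      where
      consistent-with-¬φ : Consistent (λ x → G x ⊎ x ≡ ~ φ)
      consistent-with-¬φ (M , inM , ¬M) with separate G (~ φ) inM
      ... | M′ , inM′ , ent = ¬p (closed M′ inM′ (consequence ¬M (λ v ¬Ms → ⇒-intro λ M′s →
            case-holds v (λ ¬φ → ~-elim ¬Ms (conj-intro M (ent v (conj-elim M′ M′s) (~-intro ¬φ)))))))
        where
        case-holds : ∀ v → (¬ Holds v φ → ⊥) → Holds v φ
        case-holds v k with holds? {v} φ
        ... | yes h = h
        ... | no ¬h = ⊥-elim (k ¬h)

    K-mono : ∀ {a φ ψ} → ⊢ (φ ⇒ ψ) → G (K a φ) → G (K a ψ)
    K-mono {a} {φ} {ψ} h p = mp-in (mp-in (thm-in (AxK a φ ψ)) (thm-in (NK a h))) p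

    K-closed : ∀ {a} L {φ} → All (λ y → G (K a y)) L → ⊢ (conj L ⇒ φ) → G (K a φ)
    K-closed {a} []      _        h = thm-in (NK a (MP h (valid (λ v → ⊤-holds))))
    K-closed {a} (x ∷ L) {φ} (p ∷ ps) h =
      mp-in (mp-in (thm-in (AxK a x φ))
        (K-closed L ps (consequence h (λ v h′ → ⇒-intro λ L → ⇒-intro λ x → ⇒-elim h′ (&-intro x L))))) p

  module Lindenbaum {enc : Ag → ℕ} (enc-injective : Injective _≡_ _≡_ enc) (S : FSet) (cS : Consistent S) where
    open Coding enc enc-injective

    stage : ℕ → FSet
    stage zero    x = S x
    stage (suc n) x = stage n x ⊎ (code x ≡ n × Consistent (λ y → stage n y ⊎ y ≡ x))

    Δ : FSet
    Δ x = Σ ℕ λ n → stage n x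

    stage-mono : ∀ {n m x} → n ≤ m → stage n x → stage m x
    stage-mono = go ∘ ≤⇒≤′
      where
      go : ∀ {n m x} → n ≤′ m → stage n x → stage m x
      go ≤′-refl     p = p
      go (≤′-step h) p = inj₁ (go h p)

    common-stage : ∀ {L} → All Δ L → Σ ℕ λ N → All (stage N) L
    common-stage [] = 0 , []
    common-stage ((n , p) ∷ ps) with common-stage ps
    ... | N , qs = (n ⊔ N) , (stage-mono (m≤m⊔n n N) p ∷ All.map (stage-mono (m≤n⊔m n N)) qs)

    -- A list from stage n+1 lies in stage n, or in stage n plus the (unique,
    -- by injectivity of code) formula added at step n, whose addition was consistent.
    step-cases : ∀ n {L} → All (stage (suc n)) L →
      All (stage n) L ⊎ (Σ (Fm Ag) λ x₀ → code x₀ ≡ n × Consistent (λ y → stage n y ⊎ y ≡ x₀) ×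
                          All (λ y → stage n y ⊎ y ≡ x₀) L)
    step-cases n [] = inj₁ []
    step-cases n (inj₁ p ∷ ps) with step-cases n ps
    ... | inj₁ qs = inj₁ (p ∷ qs)
    ... | inj₂ (x₀ , cx₀ , c , qs) = inj₂ (x₀ , cx₀ , c , (inj₁ p ∷ qs))
    step-cases n {x ∷ L} (inj₂ (cx , c) ∷ ps) with step-cases n ps
    ... | inj₁ qs = inj₂ (x , cx , c , (inj₂ refl ∷ All.map inj₁ qs))
    ... | inj₂ (x₀ , cx₀ , c₀ , qs) = inj₂ (x₀ , cx₀ , c₀ , (inj₂ (code-injective (trans cx (sym cx₀))) ∷ qs))

    stage-consistent : ∀ n → Consistent (stage n)
    stage-consistent zero = cS
    stage-consistent (suc n) (L , inL , d) with step-cases n inL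
    ... | inj₁ qs = stage-consistent n (L , qs , d)
    ... | inj₂ (_ , _ , c₀ , qs) = c₀ (L , qs , d)

    Δ-consistent : Consistent Δ
    Δ-consistent (L , inL , d) with common-stage inL
    ... | N , qs = stage-consistent N (L , qs , d)

    -- A formula x consistent with Δ is consistent with stage (code x), hence added there.
    Δ-maximal : (D : FSet) → Δ ⊆ D → Consistent D → D ⊆ Δ
    Δ-maximal D Δ⊆D cD x x∈D = suc (code x) , inj₂ (refl , consistent-⊆ stage+x⊆D cD)
      where
      stage+x⊆D : (λ y → stage (code x) y ⊎ y ≡ x) ⊆ D
      stage+x⊆D y (inj₁ q)    = Δ⊆D y (code x , q)
      stage+x⊆D y (inj₂ refl) = x∈D

  lindenbaum : {enc : Ag → ℕ} → Injective _≡_ _≡_ enc →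
               (S : FSet) → Consistent S → Σ FSet λ Δ → MaxCons Δ × S ⊆ Δ
  lindenbaum enc-injective S cS =
    Δ , (Δ-consistent , Δ-maximal) , (λ x p → 0 , p)
    where open Lindenbaum enc-injective S cS

  knowledge-compatible : (LEM : ExcludedMiddle 0ℓ) (Γ : FSet) → MaxCons Γ → ∀ a θ →
    ¬ Γ (K a (~ θ)) → Consistent (λ y → Γ (K a y) ⊎ y ≡ θ)
  knowledge-compatible LEM Γ mΓ a θ ¬K¬θ (L , inL , ¬L) with separate (λ y → Γ (K a y)) θ inL
  ... | M , inM , ent = ¬K¬θ (K-closed M inM (consequence ¬L (λ v ¬Ls → ⇒-intro λ Ms →
        ~-intro λ θ → ~-elim ¬Ls (conj-intro L (ent v (conj-elim M Ms) θ)))))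
    where open MaxConsProps LEM Γ mΓ

-- The size of an evidence term; an atom term counts by its index, so terms of
-- any prescribed size exist and application strictly increases size.

size : {Ag : Set} → Term Ag → ℕ
size e             = 0
size (fm (atom n)) = suc n
size (fm _)        = 0
size (t · u)       = suc (size t + size u)

module Successor (LEM : ExcludedMiddle 0ℓ) {Ag : Set} {enc : Ag → ℕ} (enc-injective : Injective _≡_ _≡_ enc)
  (Λ : Fm Ag → Set) (w : Logic.World Ag Λ) (a : Ag) (θ : Fm Ag)
  (¬K¬θ : ¬ Logic.Γ w (K a (~ θ))) (t₃ : Term Ag) where
  open Logic Ag Λ
  open Semantics using (⊤-holds; &-elim)
  open Derivations Ag Λ
  module Γw = MaxConsProps LEM (Γ w) (mcs w)

  _≟ᴬ_ : (b c : Ag) → Dec (b ≡ c)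
  b ≟ᴬ c = map′ enc-injective (cong enc) (enc b ≟ enc c)

  Known : FSet
  Known y = Γ w (K a y) ⊎ y ≡ θ

  extension : Σ FSet λ Δ → MaxCons Δ × Known ⊆ Δ
  extension = lindenbaum enc-injective Known (knowledge-compatible LEM (Γ w) (mcs w) a θ ¬K¬θ)

  Δ : FSet
  Δ = proj₁ extension

  Δ-mcs : MaxCons Δ
  Δ-mcs = proj₁ (proj₂ extension)

  module Δ = MaxConsProps LEM Δ Δ-mcs

  knowledge-in-Δ : ∀ {φ} → Γ w (K a φ) → Δ φ
  knowledge-in-Δ p = proj₂ (proj₂ extension) _ (inj₁ p)

  θ-in-Δ : Δ θ
  θ-in-Δ = proj₂ (proj₂ extension) _ (inj₂ refl)

  -- Ky_a-formulas are known (4YKR), so they pass from Γ to Δ.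
  Ky-forward : ∀ {φ ψ} → Γ w (Ky a φ ψ) → Δ (Ky a φ ψ)
  Ky-forward {φ} {ψ} p = knowledge-in-Δ (Γw.mp-in (Γw.thm-in (4YKR a φ ψ)) p)

  -- Their absence is known too (T, 5 and 4YKR), so they pass back from Δ to Γ.
  Ky-backward : ∀ {φ ψ} → Δ (Ky a φ ψ) → Γ w (Ky a φ ψ)
  Ky-backward {φ} {ψ} p with Γw.neg-complete (Ky a φ ψ)
  ... | inj₁ q  = q
  ... | inj₂ ¬q = ⊥-elim (Δ.not-both p (knowledge-in-Δ K¬Ky))
    where
    ¬KKy : Γ w (~ K a (Ky a φ ψ))
    ¬KKy = Γw.mp-in (Γw.thm-in (contrapositive (AxT a (Ky a φ ψ)))) ¬q
    K¬KKy : Γ w (K a (~ K a (Ky a φ ψ)))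
    K¬KKy = Γw.mp-in (Γw.thm-in (Ax5 a (Ky a φ ψ))) ¬KKy
    K¬Ky : Γ w (K a (~ Ky a φ ψ))
    K¬Ky = Γw.K-mono (contrapositive (4YKR a φ ψ)) K¬KKy

  Fresh : Term Ag → Set
  Fresh t = size t₃ < size t

  fresh-term : Term Ag
  fresh-term = fm (atom (size t₃))

  G : Ec Ag → Fm Ag → Set
  G (t , α) ψ = InEc (t , α) × Δ α × (Δ (Ky a α ψ) ⊎ Fresh t)

  g : Ag → Fm Ag → Fm Ag → Ec Ag
  g b φ ψ with b ≟ᴬ a
  ... | yes _ = f w a φ ψ
  ... | no _  = fresh-term , φ

  g-agrees : ∀ φ ψ → f w a φ ψ ≡ g a φ ψ
  g-agrees φ ψ with a ≟ᴬ a
  ... | yes _  = refl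
  ... | no a≢a = ⊥-elim (a≢a refl)

  g-in-Ec : ∀ b φ ψ → Δ (Ky b φ ψ) → InEc (g b φ ψ)
  g-in-Ec b φ ψ k with b ≟ᴬ a
  ... | yes refl = fEc w a φ ψ (Ky-backward k)
  ... | no _     = inj₁ (λ ())

  g-indexed : ∀ b φ ψ → Δ (Ky b φ ψ) → Σ (Term Ag) λ t → g b φ ψ ≡ (t , φ)
  g-indexed b φ ψ k with b ≟ᴬ a
  ... | yes refl = c4 w a φ ψ (Ky-backward k)
  ... | no _     = fresh-term , refl

  -- Condition (1): by EKyR, or because an application of a fresh term is fresh.
  G-application : ∀ s r φ ψ → G s (φ ⇒ ψ) → G r φ → G (s ⊙ r) ψ
  G-application (t , α) (u , β) φ ψ (_ , α∈Δ , jt) (_ , β∈Δ , ju) =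
    inj₁ (λ ()) , Δ.and-in α∈Δ β∈Δ , combine jt ju
    where
    combine : Δ (Ky a α (φ ⇒ ψ)) ⊎ Fresh t → Δ (Ky a β φ) ⊎ Fresh u → Δ (Ky a (α & β) ψ) ⊎ Fresh (t · u)
    combine (inj₁ k₁) (inj₁ k₂) = inj₁ (Δ.mp-in (Δ.mp-in (Δ.thm-in (EKyR a α φ ψ β)) k₁) k₂)
    combine (inj₂ fr) _         = inj₂ (≤-trans fr (≤-trans (m≤m+n (size t) (size u)) (n≤1+n _)))
    combine (inj₁ _)  (inj₂ fr) = inj₂ (≤-trans fr (≤-trans (m≤n+m (size u) (size t)) (n≤1+n _)))

  G-ground : ∀ φ → Λ φ → G eTop φ
  G-ground φ l = inj₂ (refl , refl) , Δ.thm-in (valid (λ v → ⊤-holds)) , inj₁ (Δ.thm-in (NKyR a l))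

  inherited-witness : ∀ φ ψ → Γ w (Ky a φ ψ) → Δ φ → G (f w a φ ψ) ψ
  inherited-witness φ ψ k φ∈Δ with f w a φ ψ | fEc w a φ ψ k | c4 w a φ ψ k
  ... | _ | in-Ec | _ , refl = in-Ec , φ∈Δ , inj₁ (Ky-forward k)

  G-witness : ∀ b φ ψ → Δ (Ky b φ ψ & φ) → G (g b φ ψ) ψ
  G-witness b φ ψ k&φ with b ≟ᴬ a
  ... | yes refl = inherited-witness φ ψ (Ky-backward (Δ.entails-in (λ _ → proj₁ ∘ &-elim) k&φ))
                                         (Δ.entails-in (λ _ → proj₂ ∘ &-elim) k&φ)
  ... | no _     = inj₁ (λ ()) , Δ.entails-in (λ _ → proj₂ ∘ &-elim) k&φ , inj₂ (n<1+n _)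

  v : World
  v = record
    { Γ = Δ ; mcs = Δ-mcs ; F = G ; F⊆ = λ _ _ → proj₁
    ; f = g ; fEc = g-in-Ec
    ; c1 = G-application ; c2 = G-ground ; c3 = G-witness ; c4 = g-indexed }

  w-Rc-v : Rc a w v
  w-Rc-v = (λ φ → knowledge-in-Δ) ,
           (λ φ → ((λ ψ → Ky-forward) , (λ ψ → Ky-backward)) , (λ ψ _ → g-agrees φ ψ))

  G-sound : ∀ t α ψ → G (t , α) ψ → Δ α × (Γ w (Ky a α ψ) ⊎ Fresh t)
  G-sound t α ψ (_ , α∈Δ , inj₁ k)  = α∈Δ , inj₁ (Ky-backward k)
  G-sound t α ψ (_ , α∈Δ , inj₂ fr) = α∈Δ , inj₂ fr

successor : ExcludedMiddle 0ℓ → {Ag : Set} {enc : Ag → ℕ} → Injective _≡_ _≡_ enc →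
  (Λ : Fm Ag → Set) (w : Logic.World Ag Λ) (a : Ag) (θ : Fm Ag) →
  ¬ Logic.Γ w (K a (~ θ)) → (t₃ : Term Ag) →
  Σ (Logic.World Ag Λ) λ v → Logic.Rc Ag Λ a w v × Logic.Γ v θ ×
    (∀ t α ψ → Logic.F v (t , α) ψ → Logic.Γ v α × (Logic.Γ w (Ky a α ψ) ⊎ size t₃ < size t))
successor LEM enc-injective Λ w a θ ¬K¬θ t₃ = v , w-Rc-v , θ-in-Δ , G-sound
  where open Successor LEM enc-injective Λ w a θ ¬K¬θ t₃

module Refutation (LEM : ExcludedMiddle 0ℓ) {Ag : Set} {enc : Ag → ℕ} (enc-injective : Injective _≡_ _≡_ enc)
  (Λ : Fm Ag → Set) (w : Logic.World Ag Λ) (a : Ag) (φ₁ φ₂ : Fm Ag)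
  (¬Ky : ¬ Logic.Γ w (Ky a φ₁ φ₂)) (t₃ : Term Ag) (φ₃ : Fm Ag) where
  open Logic Ag Λ
  open Semantics using (&-elim)
  open Derivations Ag Λ
  module Γw = MaxConsProps LEM (Γ w) (mcs w)

  Refuting : Set₁
  Refuting = Σ World λ v → Rc a w v × Γ v φ₁ × ¬ F v (t₃ , φ₃) φ₂

  -- If Ky_a(φ₃,φ₂) ∈ Γ then K_a(φ₁ → φ₃) ∉ Γ by IKyR; a successor containing φ₁ ∧ ¬φ₃
  -- refutes (s,φ₂), since that evidence would require φ₃.
  unknown-implication : Γ w (Ky a φ₃ φ₂) → ¬ Γ w (K a (φ₁ ⇒ φ₃))
  unknown-implication Ky₃ known = ¬Ky (Γw.mp-in (Γw.mp-in (Γw.thm-in (IKyR a φ₁ φ₃ φ₂)) Ky₃) known)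

  when-known : Γ w (Ky a φ₃ φ₂) → Refuting
  when-known Ky₃ with successor LEM enc-injective Λ w a (φ₁ & ~ φ₃) (unknown-implication Ky₃) t₃
  ... | v , Rc-v , θ∈v , sound = v , Rc-v , v.entails-in (λ _ → proj₁ ∘ &-elim) θ∈v ,
        λ G → v.not-both (proj₁ (sound t₃ φ₃ φ₂ G)) (v.entails-in (λ _ → proj₂ ∘ &-elim) θ∈v)
    where module v = MaxConsProps LEM (Γ v) (mcs v)

  -- If Ky_a(φ₃,φ₂) ∉ Γ then K_a ¬φ₁ ∉ Γ by UKyR; in a successor containing φ₁ the
  -- evidence (s,φ₂) would need Ky_a(φ₃,φ₂) ∈ Γ or t₃ larger than itself.
  φ₁-possible : ¬ Γ w (K a (~ φ₁))
  φ₁-possible known = ¬Ky (Γw.mp-in (Γw.thm-in (UKyR a φ₁ φ₂)) known)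

  when-unknown : ¬ Γ w (Ky a φ₃ φ₂) → Refuting
  when-unknown ¬Ky₃ with successor LEM enc-injective Λ w a φ₁ φ₁-possible t₃
  ... | v , Rc-v , φ₁∈v , sound = v , Rc-v , φ₁∈v , λ G → impossible (proj₂ (sound t₃ φ₃ φ₂ G))
    where
    impossible : Γ w (Ky a φ₃ φ₂) ⊎ size t₃ < size t₃ → ⊥
    impossible (inj₁ Ky₃)   = ¬Ky₃ Ky₃
    impossible (inj₂ t₃<t₃) = <-irrefl refl t₃<t₃

lemma3p24 : ExcludedMiddle 0ℓ →
    (Ag : Set) (enc : Ag → ℕ) → Injective _≡_ _≡_ enc →
    (Λ : Fm Ag → Set) →
    (w : Logic.World Ag Λ) (a : Ag) (φ₁ φ₂ : Fm Ag) →
    ¬ Logic.Γ w (Ky a φ₁ φ₂) →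
    (s : Ec Ag) → InEc s →
    Σ (Logic.World Ag Λ) λ v →
      Logic.Rc Ag Λ a w v × Logic.Γ v φ₁ × ¬ Logic.F v s φ₂
lemma3p24 LEM Ag enc enc-injective Λ w a φ₁ φ₂ ¬Ky (t₃ , φ₃) _ with LEM {Logic.Γ w (Ky a φ₃ φ₂)}
... | yes Ky₃  = when-known Ky₃
  where open Refutation LEM enc-injective Λ w a φ₁ φ₂ ¬Ky t₃ φ₃
... | no ¬Ky₃ = when-unknown ¬Ky₃
  where open Refutation LEM enc-injective Λ w a φ₁ φ₂ ¬Ky t₃ φ₃
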